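{- The series $\mathcal{VO}_d(z,q)$ and $\mathcal{XO}_d(z,q)$ belong to $\mathscr{T}_{z,q}^2$. In particular, for all integers $m,n\ge0$: $VO_d(m,n)>VO_d(m+2,n)$ provided $VO_d(m,n)\ne0$, and $XO_d(m,n)>XO_d(m+2,n)$ provided $XO_d(m,n)\ne0$.
   Context: $(a;q)_n=\prod_{0\le j<n}(1-aq^j)$ for $n\in\mathbb{N}_0\cup\{\infty\}$, $(a,b;q)_n=(a;q)_n(b;q)_n$. Define $$\mathcal{VO}_d(z,q)=\sum_{n\ge0}\sum_mVO_d(m,n)z^mq^n=\sum_{n\ge1}q^{2n-1}(-zq^{2n+1},-z^{ -1}q^{2n+1};q^2)_\infty,$$ $$\mathcal{XO}_d(z,q)=\sum_{n\ge0}\sum_mXO_d(m,n)z^mq^n=\sum_{n\ge0}q^{2n+1}(-zq,-z^{ -1}q;q^2)_n.$$ $\mathscr{T}_z^2$ is the set of Laurent polynomials $\sum_ic_iz^i$ with real $c_i\ge0$, $c_{ -i}=c_i$, and for $r\in\{0,1\}$, $\ell\ge0$: $c_{r+2\ell}\ge c_{r+2(\ell+1)}$, strictly whenever $c_{r+2\ell}>0$; a series $\sum_nC_n(z)q^n$ lies in $\mathscr{T}_{z,q}^2$ if every $C_n(z)\in\mathscr{T}_z^2$. -}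

module Defs where

open import Data.Nat as ℕ using (ℕ; zero; suc; _<_; _≤_; _≥_; _>_)
open import Data.Integer as ℤ using (ℤ; +_; -[1+_])
open import Data.List using (List; []; _∷_; _++_; map; concatMap; length; filter; upTo)
open import Data.Product using (_×_; _,_)
open import Relation.Nullary.Decidable using (_×-dec_)
open import Relation.Binary.PropositionalEquality using (_≡_)

-- A bivariate Laurent polynomial in z and polynomial in q with natural
-- coefficients, represented as a formal sum of monomials z^a q^b
-- (each list entry (a , b) stands for the monomial z^a q^b, coefficient 1;
-- repeated entries add up).
Poly : Set
Poly = List (ℤ × ℕ)

one : Poly
one = (+ 0 , 0) ∷ []

_⊕_ : Poly → Poly → Poly
P ⊕ Q = P ++ Q

_⊗_ : Poly → Poly → Poly
P ⊗ Q = concatMap (λ { (a , b) → map (λ { (c , d) → (a ℤ.+ c , b ℕ.+ d) }) Q }) P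

qpow : ℕ → Poly
qpow k = (+ 0 , k) ∷ []

coeff : Poly → ℤ → ℕ → ℕ
coeff P m n = length (filter (λ { (a , b) → (a ℤ.≟ m) ×-dec (b ℕ.≟ n) }) P)

Σ-over : List ℕ → (ℕ → Poly) → Poly
Σ-over [] f = []
Σ-over (i ∷ is) f = f i ⊕ Σ-over is f

Π-over : List ℕ → (ℕ → Poly) → Poly
Π-over [] f = one
Π-over (i ∷ is) f = f i ⊗ Π-over is f

pairFactor : ℕ → Poly
pairFactor e = ((+ 0 , 0) ∷ (+ 1 , e) ∷ []) ⊗ ((+ 0 , 0) ∷ (-[1+ 0 ] , e) ∷ [])

range : ℕ → ℕ → List ℕ
range a b = map (a ℕ.+_) (upTo (b ℕ.∸ a))

-- Truncation of VO_d(z,q) = Σ_{k≥1} q^{2k-1} (-z q^{2k+1}, -z^{-1} q^{2k+1}; q^2)_∞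
-- keeping k = 1..N and the factors j = k..N of the infinite product
-- (factor j is (1+z q^{2j+1})(1+z^{-1} q^{2j+1})).
-- All omitted summands / nontrivial factor parts have q-degree > N,
-- so the coefficient of q^n is exact for N = n.
VOtrunc : ℕ → Poly
VOtrunc N = Σ-over (range 1 (suc N)) (λ k →
  qpow (2 ℕ.* k ℕ.∸ 1) ⊗ Π-over (range k (suc N)) (λ j → pairFactor (2 ℕ.* j ℕ.+ 1)))

-- Truncation of XO_d(z,q) = Σ_{k≥0} q^{2k+1} (-z q, -z^{-1} q; q^2)_k keeping k = 0..N
-- (summands with k > N have q-degree > N).
XOtrunc : ℕ → Poly
XOtrunc N = Σ-over (range 0 (suc N)) (λ k →
  qpow (2 ℕ.* k ℕ.+ 1) ⊗ Π-over (range 0 k) (λ j → pairFactor (2 ℕ.* j ℕ.+ 1)))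

VOd : ℤ → ℕ → ℕ
VOd m n = coeff (VOtrunc n) m n

XOd : ℤ → ℕ → ℕ
XOd m n = coeff (XOtrunc n) m n

-- The class 𝒯_z^2 for a Laurent polynomial given by its coefficient function c
-- (coefficients are natural numbers, so nonnegativity is automatic).
InT2z : (ℤ → ℕ) → Set
InT2z c =
  (∀ (i : ℤ) → c (ℤ.- i) ≡ c i) ×
  (∀ (r ℓ : ℕ) → r < 2 →
     (c (+ (r ℕ.+ 2 ℕ.* ℓ)) ≥ c (+ (r ℕ.+ 2 ℕ.* suc ℓ))) ×
     (0 < c (+ (r ℕ.+ 2 ℕ.* ℓ)) → c (+ (r ℕ.+ 2 ℕ.* ℓ)) > c (+ (r ℕ.+ 2 ℕ.* suc ℓ))))

InT2zq : (ℤ → ℕ → ℕ) → Set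
InT2zq C = ∀ (n : ℕ) → InT2z (λ m → C m n)

{-# OPTIONS --safe #-}
-- Every summand of VO_d and XO_d is a power of q times a product of factors
-- (1 + z q^e)(1 + z⁻¹ q^e) = 1 + (z + z⁻¹) q^e + q^(2e). Having every
-- q-coefficient in 𝒯²_z holds for 1 and survives sums and multiplication by
-- q^b, so everything reduces to multiplication by z + z⁻¹. The coefficient of
-- z^k in (z + z⁻¹) C(z) is c(k+1) + c(k-1); for k ≥ 1 its two-step decrease
-- follows termwise from that of c at k+1 and k-1, and for k = 0 it follows
-- from the symmetry c(-1) = c(1).
module Submission where

open import Defs
open import Data.Integer as ℤ using (ℤ; +_; -[1+_]; 1ℤ)
import Data.Integer.Properties as ℤ
import Data.Integer.Tactic.RingSolver as ℤ-Solver
open import Data.List using ([]; _∷_; _++_; map; filter; length)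
open import Data.List.Properties
  using (length-++; filter-++; filter-none; concatMap-++; ++-identityʳ; map-cong)
open import Data.List.Relation.Unary.All using (universal)
open import Data.List.Relation.Unary.All.Properties using (map⁺)
open import Data.Nat as ℕ using (ℕ; zero; suc; pred; _+_; _≤_; _<_; z≤n; s≤s)
import Data.Nat.Properties as ℕ
import Data.Nat.Tactic.RingSolver as ℕ-Solver
open import Data.Product using (_×_; _,_)
open import Function using (_∘_)
open import Relation.Binary.PropositionalEquality
open import Relation.Nullary using (¬_; yes; no; contradiction)
open import Relation.Unary using (Pred; Decidable)

private
  variable
    c d : ℤ → ℕ
    P Q : Poly

pred[m]+pred[n]≤pred[m+n] : ∀ m n → pred m + pred n ≤ pred (m + n)
pred[m]+pred[n]≤pred[m+n] zero    n = ℕ.≤-refl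
pred[m]+pred[n]≤pred[m+n] (suc m) n = ℕ.+-monoʳ-≤ m ℕ.pred[n]≤n

pred[n]+n≡pred[n+n] : ∀ n → pred n + n ≡ pred (n + n)
pred[n]+n≡pred[n+n] zero    = refl
pred[n]+n≡pred[n+n] (suc n) = refl

m+2[1+n]≡2+[m+2n] : ∀ m n → m + 2 ℕ.* suc n ≡ 2 + (m + 2 ℕ.* n)
m+2[1+n]≡2+[m+2n] = ℕ-Solver.solve-∀

-i+1≡-[i-1] : ∀ i → ℤ.- i ℤ.+ 1ℤ ≡ ℤ.- (i ℤ.- 1ℤ)
-i+1≡-[i-1] = ℤ-Solver.solve-∀

-i-1≡-[i+1] : ∀ i → ℤ.- i ℤ.- 1ℤ ≡ ℤ.- (i ℤ.+ 1ℤ)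
-i-1≡-[i+1] = ℤ-Solver.solve-∀

i+j-i≡j : ∀ i j → i ℤ.+ j ℤ.- i ≡ j
i+j-i≡j = ℤ-Solver.solve-∀

i+[j-i]≡j : ∀ i j → i ℤ.+ (j ℤ.- i) ≡ j
i+[j-i]≡j = ℤ-Solver.solve-∀

data Offset (b : ℕ) : ℕ → Set where
  below : ∀ {n} → n < b → Offset b n
  above : ∀ o → Offset b (b + o)

offset : ∀ b n → Offset b n
offset zero    n       = above n
offset (suc b) zero    = below ℕ.z<s
offset (suc b) (suc n) with offset b n
... | below n<b = below (s≤s n<b)
... | above o   = above o

module _ {a b p q} {A : Set a} {B : Set b} {P : Pred A p} {Q : Pred B q}
         (P? : Decidable P) (Q? : Decidable Q) (f : B → A) where

  length-filter-map : (∀ {y} → P (f y) → Q y) → (∀ {y} → Q y → P (f y)) →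
                      ∀ ys → length (filter P? (map f ys)) ≡ length (filter Q? ys)
  length-filter-map P⇒Q Q⇒P []       = refl
  length-filter-map P⇒Q Q⇒P (y ∷ ys) with P? (f y) | Q? y
  ... | yes _  | yes _  = cong suc (length-filter-map P⇒Q Q⇒P ys)
  ... | no _   | no _   = length-filter-map P⇒Q Q⇒P ys
  ... | yes p  | no ¬q  = contradiction (P⇒Q p) ¬q
  ... | no ¬p  | yes q  = contradiction (Q⇒P q) ¬p

length-filter-map-none : ∀ {a b p} {A : Set a} {B : Set b} {P : Pred A p}
                         (P? : Decidable P) (f : B → A) → (∀ y → ¬ P (f y)) →
                         ∀ ys → length (filter P? (map f ys)) ≡ 0
length-filter-map-none P? f ¬P∘f ys =
  cong length (filter-none P? (map⁺ (universal ¬P∘f ys)))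

-- c (k + 2) ≤ pred (c k) says at once that c decreases in steps of two and
-- that it does so strictly while positive.
record T² (c : ℤ → ℕ) : Set where
  field
    symmetric  : ∀ i → c (ℤ.- i) ≡ c i
    decreasing : ∀ k → c (+ (2 + k)) ≤ pred (c (+ k))

open T²

T²-resp-≗ : c ≗ d → T² c → T² d
T²-resp-≗ c≗d t = record
  { symmetric  = λ i → trans (sym (c≗d _)) (trans (symmetric t i) (c≗d i))
  ; decreasing = λ k → subst₂ (λ x y → x ≤ pred y) (c≗d _) (c≗d _) (decreasing t k)
  }

T²-zero : T² (λ _ → 0)
T²-zero = record { symmetric = λ _ → refl ; decreasing = λ _ → z≤n }

T²-+ : T² c → T² d → T² (λ m → c m + d m)
T²-+ {c} {d} s t = record
  { symmetric  = λ i → cong₂ _+_ (symmetric s i) (symmetric t i)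
  ; decreasing = λ k → ℕ.≤-trans (ℕ.+-mono-≤ (decreasing s k) (decreasing t k))
                                 (pred[m]+pred[n]≤pred[m+n] (c (+ k)) (d (+ k)))
  }

T²-[z+z⁻¹] : T² c → T² (λ m → c (m ℤ.+ 1ℤ) + c (m ℤ.- 1ℤ))
T²-[z+z⁻¹] {c} t = record { symmetric = symmetric′ ; decreasing = decreasing′ }
  where
  open ℕ.≤-Reasoning
  D : ℤ → ℕ
  D m = c (m ℤ.+ 1ℤ) + c (m ℤ.- 1ℤ)

  symmetric′ : ∀ i → D (ℤ.- i) ≡ D i
  symmetric′ i = begin-equality
    c (ℤ.- i ℤ.+ 1ℤ) + c (ℤ.- i ℤ.- 1ℤ)
      ≡⟨ cong₂ _+_ (cong c (-i+1≡-[i-1] i)) (cong c (-i-1≡-[i+1] i)) ⟩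
    c (ℤ.- (i ℤ.- 1ℤ)) + c (ℤ.- (i ℤ.+ 1ℤ))
      ≡⟨ cong₂ _+_ (symmetric t (i ℤ.- 1ℤ)) (symmetric t (i ℤ.+ 1ℤ)) ⟩
    c (i ℤ.- 1ℤ) + c (i ℤ.+ 1ℤ)
      ≡⟨ ℕ.+-comm (c (i ℤ.- 1ℤ)) _ ⟩
    D i ∎

  c[1+k] : ∀ k → c (+ k ℤ.+ 1ℤ) ≡ c (+ suc k)
  c[1+k] k = cong (c ∘ +_) (ℕ.+-comm k 1)

  decreasing′ : ∀ k → D (+ (2 + k)) ≤ pred (D (+ k))
  decreasing′ zero = begin
    c (+ 3) + c (+ 1)
      ≤⟨ ℕ.+-monoˡ-≤ _ (decreasing t 1) ⟩
    pred (c (+ 1)) + c (+ 1)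
      ≡⟨ pred[n]+n≡pred[n+n] (c (+ 1)) ⟩
    pred (c (+ 1) + c (+ 1))
      ≡⟨ cong (λ x → pred (c (+ 1) + x)) (symmetric t (+ 1)) ⟨
    pred (D (+ 0)) ∎
  decreasing′ (suc k) = begin
    D (+ (3 + k))
      ≡⟨ cong (_+ c (+ (2 + k))) (c[1+k] (3 + k)) ⟩
    c (+ (4 + k)) + c (+ (2 + k))
      ≤⟨ ℕ.+-mono-≤ (decreasing t (2 + k)) (decreasing t k) ⟩
    pred (c (+ (2 + k))) + pred (c (+ k))
      ≤⟨ pred[m]+pred[n]≤pred[m+n] (c (+ (2 + k))) (c (+ k)) ⟩
    pred (c (+ (2 + k)) + c (+ k))
      ≡⟨ cong (λ x → pred (x + c (+ k))) (c[1+k] (1 + k)) ⟨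
    pred (D (+ (1 + k))) ∎

T²⇒InT2z : T² c → InT2z c
T²⇒InT2z {c} t = symmetric t , λ r ℓ _ →
  let step = subst (λ j → c (+ j) ≤ pred (c (+ (r + 2 ℕ.* ℓ))))
                   (sym (m+2[1+n]≡2+[m+2n] r ℓ)) (decreasing t (r + 2 ℕ.* ℓ))
  in ℕ.≤pred⇒≤ step , λ 0<c → ℕ.m≤pred[n]⇒suc[m]≤n {{ℕ.>-nonZero 0<c}} step

⊗-distribʳ-++ : ∀ S T P → (S ++ T) ⊗ P ≡ S ⊗ P ++ T ⊗ P
⊗-distribʳ-++ S T P = concatMap-++ _ S T

coeff-++ : ∀ P Q m n → coeff (P ++ Q) m n ≡ coeff P m n + coeff Q m n
coeff-++ P Q m n = trans (cong length (filter-++ _ P Q)) (length-++ (filter _ P))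

shift : ℤ → ℕ → ℤ × ℕ → ℤ × ℕ
shift a b (c , d) = (a ℤ.+ c , b + d)

monomial-⊗ : ∀ a b P → ((a , b) ∷ []) ⊗ P ≡ map (shift a b) P
monomial-⊗ a b P = trans (++-identityʳ _) (map-cong (λ { (c , d) → refl }) P)

coeff-monomial-⊗ : ∀ a b P m n →
                   coeff (((a , b) ∷ []) ⊗ P) m (b + n) ≡ coeff P (m ℤ.- a) n
coeff-monomial-⊗ a b P m n =
  trans (cong (λ R → coeff R m (b + n)) (monomial-⊗ a b P))
        (length-filter-map _ _ (shift a b)
          (λ { {c , d} (refl , b+d≡b+n) →
                 sym (i+j-i≡j a c) , ℕ.+-cancelˡ-≡ b d n b+d≡b+n })
          (λ { {c , d} (refl , refl) → i+[j-i]≡j a m , refl })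
          P)

coeff-monomial-⊗-< : ∀ a {b} P m {n} → n < b → coeff (((a , b) ∷ []) ⊗ P) m n ≡ 0
coeff-monomial-⊗-< a {b} P m {n} n<b =
  trans (cong (λ R → coeff R m n) (monomial-⊗ a b P))
        (length-filter-map-none _ (shift a b)
          (λ { (c , d) (_ , b+d≡n) → ℕ.m+n≮m b d (subst (_< b) (sym b+d≡n) n<b) })
          P)

coeff-++-⊗ : ∀ S T P m n →
             coeff ((S ++ T) ⊗ P) m n ≡ coeff (S ⊗ P) m n + coeff (T ⊗ P) m n
coeff-++-⊗ S T P m n =
  trans (cong (λ R → coeff R m n) (⊗-distribʳ-++ S T P)) (coeff-++ (S ⊗ P) (T ⊗ P) m n)

record T²Poly (P : Poly) : Set where
  field
    degree : ∀ n → T² (λ m → coeff P m n)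

open T²Poly

T²Poly-[] : T²Poly []
T²Poly-[] .degree _ = T²-zero

T²Poly-one : T²Poly one
T²Poly-one .degree n = record { symmetric = symmetric′ ; decreasing = λ _ → z≤n }
  where
  symmetric′ : ∀ i → coeff one (ℤ.- i) n ≡ coeff one i n
  symmetric′ (+ zero)  = refl
  symmetric′ (+ suc _) = refl
  symmetric′ -[1+ _ ]  = refl

T²Poly-++ : T²Poly P → T²Poly Q → T²Poly (P ++ Q)
T²Poly-++ {P} {Q} s t .degree n =
  T²-resp-≗ (λ m → sym (coeff-++ P Q m n)) (T²-+ (s .degree n) (t .degree n))

T²Poly-qpow-⊗ : ∀ b → T²Poly P → T²Poly (qpow b ⊗ P)
T²Poly-qpow-⊗ {P} b t .degree n with offset b n
... | below n<b = T²-resp-≗ (λ m → sym (coeff-monomial-⊗-< (+ 0) P m n<b)) T²-zero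
... | above o   = T²-resp-≗ coeff≗ (t .degree o)
  where
  coeff≗ : ∀ m → coeff P m o ≡ coeff (qpow b ⊗ P) m (b + o)
  coeff≗ m = sym (trans (coeff-monomial-⊗ (+ 0) b P m o)
                        (cong (λ i → coeff P i o) (ℤ.+-identityʳ m)))

[z+z⁻¹]q^ : ℕ → Poly
[z+z⁻¹]q^ e = (-[1+ 0 ] , e) ∷ (+ 1 , e) ∷ []

T²Poly-[z+z⁻¹]q^-⊗ : ∀ e → T²Poly P → T²Poly ([z+z⁻¹]q^ e ⊗ P)
T²Poly-[z+z⁻¹]q^-⊗ {P} e t .degree n with offset e n
... | below n<e = T²-resp-≗ coeff≗ T²-zero
  where
  coeff≗ : ∀ m → 0 ≡ coeff ([z+z⁻¹]q^ e ⊗ P) m n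
  coeff≗ m = sym (trans (coeff-++-⊗ ((-[1+ 0 ] , e) ∷ []) ((+ 1 , e) ∷ []) P m n)
                        (cong₂ _+_ (coeff-monomial-⊗-< -[1+ 0 ] P m n<e)
                                   (coeff-monomial-⊗-< (+ 1) P m n<e)))
... | above o = T²-resp-≗ coeff≗ (T²-[z+z⁻¹] (t .degree o))
  where
  coeff≗ : ∀ m → coeff P (m ℤ.+ 1ℤ) o + coeff P (m ℤ.- 1ℤ) o
                ≡ coeff ([z+z⁻¹]q^ e ⊗ P) m (e + o)
  coeff≗ m = sym (trans (coeff-++-⊗ ((-[1+ 0 ] , e) ∷ []) ((+ 1 , e) ∷ []) P m (e + o))
                        (cong₂ _+_ (coeff-monomial-⊗ -[1+ 0 ] e P m o)
                                   (coeff-monomial-⊗ (+ 1) e P m o)))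

pairFactor≡1+[z+z⁻¹]q^e+q^2e : ∀ e → pairFactor e ≡ one ++ [z+z⁻¹]q^ e ++ qpow (e + e)
pairFactor≡1+[z+z⁻¹]q^e+q^2e e =
  cong (λ x → (+ 0 , 0) ∷ (-[1+ 0 ] , e) ∷ (+ 1 , x) ∷ (+ 0 , e + e) ∷ []) (ℕ.+-identityʳ e)

T²Poly-pairFactor-⊗ : ∀ e → T²Poly P → T²Poly (pairFactor e ⊗ P)
T²Poly-pairFactor-⊗ {P} e t = subst T²Poly (sym expand)
  (T²Poly-++ (T²Poly-qpow-⊗ 0 t)
             (T²Poly-++ (T²Poly-[z+z⁻¹]q^-⊗ e t) (T²Poly-qpow-⊗ (e + e) t)))
  where
  open ≡-Reasoning
  expand : pairFactor e ⊗ P ≡ one ⊗ P ++ [z+z⁻¹]q^ e ⊗ P ++ qpow (e + e) ⊗ P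
  expand = begin
    pairFactor e ⊗ P
      ≡⟨ cong (_⊗ P) (pairFactor≡1+[z+z⁻¹]q^e+q^2e e) ⟩
    (one ++ [z+z⁻¹]q^ e ++ qpow (e + e)) ⊗ P
      ≡⟨ ⊗-distribʳ-++ one ([z+z⁻¹]q^ e ++ qpow (e + e)) P ⟩
    one ⊗ P ++ ([z+z⁻¹]q^ e ++ qpow (e + e)) ⊗ P
      ≡⟨ cong (one ⊗ P ++_) (⊗-distribʳ-++ ([z+z⁻¹]q^ e) (qpow (e + e)) P) ⟩
    one ⊗ P ++ [z+z⁻¹]q^ e ⊗ P ++ qpow (e + e) ⊗ P ∎

T²Poly-Σ-over : ∀ is f → (∀ i → T²Poly (f i)) → T²Poly (Σ-over is f)
T²Poly-Σ-over []       f t = T²Poly-[]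
T²Poly-Σ-over (i ∷ is) f t = T²Poly-++ (t i) (T²Poly-Σ-over is f t)

T²Poly-Π-over : ∀ is f → (∀ i {P} → T²Poly P → T²Poly (f i ⊗ P)) →
                T²Poly (Π-over is f)
T²Poly-Π-over []       f t = T²Poly-one
T²Poly-Π-over (i ∷ is) f t = t i (T²Poly-Π-over is f t)

T²Poly-VOtrunc : ∀ N → T²Poly (VOtrunc N)
T²Poly-VOtrunc N = T²Poly-Σ-over (range 1 (suc N)) _ λ k →
  T²Poly-qpow-⊗ (2 ℕ.* k ℕ.∸ 1) (T²Poly-Π-over (range k (suc N)) _ λ j →
    T²Poly-pairFactor-⊗ (2 ℕ.* j + 1))

T²Poly-XOtrunc : ∀ N → T²Poly (XOtrunc N)
T²Poly-XOtrunc N = T²Poly-Σ-over (range 0 (suc N)) _ λ k →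
  T²Poly-qpow-⊗ (2 ℕ.* k + 1) (T²Poly-Π-over (range 0 k) _ λ j →
    T²Poly-pairFactor-⊗ (2 ℕ.* j + 1))

theorem4p9 : InT2zq VOd × InT2zq XOd
theorem4p9 = (λ n → T²⇒InT2z (T²Poly-VOtrunc n .degree n))
           , (λ n → T²⇒InT2z (T²Poly-XOtrunc n .degree n))
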